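{- For $n\geq 2$, the number of permutations $\pi\in\mathcal{S}_n$ avoiding $321$ with $\theta^2(\pi)=\pi$ equals $F_{n+1}$, the $(n+1)$-st Fibonacci number.
   Context: $\mathcal{S}_n$ is the symmetric group on $[n]$, permutations in one-line notation $\pi_1\cdots\pi_n$. A permutation avoids a pattern $\tau$ if it has no subsequence order-isomorphic to $\tau$. The standard cycle notation of $\pi$ writes each cycle (fixed points included) with its largest element first and orders cycles by increasing largest element. The fundamental bijection $\theta:\mathcal{S}_n\to\mathcal{S}_n$ maps $\pi$ to the permutation whose one-line notation is obtained by erasing the parentheses of the standard cycle notation of $\pi$; $\theta^2=\theta\circ\theta$. Fibonacci numbers: $F_0=0$, $F_1=F_2=1$, $F_m=F_{m-1}+F_{m-2}$. -}

module Defs where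

open import Data.Nat using (ℕ; zero; suc; _+_; _<_; _<ᵇ_; _≡ᵇ_)
open import Data.Bool using (Bool; true; false; if_then_else_; _∧_; _∨_; not)
open import Data.List using (List; []; _∷_; _++_; length; concatMap)
open import Data.Product using (_×_)
open import Relation.Binary.PropositionalEquality using (_≡_)
open import Data.List.Relation.Binary.Permutation.Propositional using (_↭_)

fib : ℕ → ℕ
fib zero = 0
fib (suc zero) = 1
fib (suc (suc m)) = fib (suc m) + fib m

oneTo : ℕ → List ℕ
oneTo zero = []
oneTo (suc n) = oneTo n ++ (suc n ∷ [])

-- A permutation of [n] in one-line notation: a list π₁ ⋯ πₙ which is a
-- rearrangement of 1,…,n.
IsPerm : ℕ → List ℕ → Set
IsPerm n π = π ↭ oneTo n

-- π contains 321: indices i < j < k with πᵢ > πⱼ > πₖ.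
-- contains321 checks for a subsequence a > b > c.
private
  anyLess : ℕ → List ℕ → Bool
  anyLess b [] = false
  anyLess b (c ∷ cs) = (c <ᵇ b) ∨ anyLess b cs

  any21 : ℕ → List ℕ → Bool
  any21 a [] = false
  any21 a (b ∷ bs) = ((b <ᵇ a) ∧ anyLess b bs) ∨ any21 a bs

contains321 : List ℕ → Bool
contains321 [] = false
contains321 (a ∷ as) = any21 a as ∨ contains321 as

Avoids321 : List ℕ → Set
Avoids321 π = contains321 π ≡ false

-- value π(i) of a one-line permutation (1-indexed); 0 if out of range
at : List ℕ → ℕ → ℕ
at [] i = 0
at (x ∷ xs) zero = 0
at (x ∷ xs) (suc zero) = x
at (x ∷ xs) (suc (suc i)) = at xs (suc i)

orbitFrom : List ℕ → ℕ → ℕ → ℕ → List ℕ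
orbitFrom π m zero x = []
orbitFrom π m (suc f) x = if x ≡ᵇ m then [] else x ∷ orbitFrom π m f (at π x)

cycleOf : List ℕ → ℕ → List ℕ
cycleOf π m = m ∷ orbitFrom π m (length π) (at π m)

anyGreater : ℕ → List ℕ → Bool
anyGreater m [] = false
anyGreater m (x ∷ xs) = (m <ᵇ x) ∨ anyGreater m xs

isCycleMax : List ℕ → ℕ → Bool
isCycleMax π m = not (anyGreater m (cycleOf π m))

-- Standard cycle notation with parentheses erased: cycles written with their
-- largest element first, cycles ordered by increasing largest element.
θ : List ℕ → List ℕ
θ π = concatMap (λ m → if isCycleMax π m then cycleOf π m else []) (oneTo (length π))

-- The permutations in question are exactly the direct sums of copies of 1 and 21, counted by the
-- Fibonacci recursion according to whether the last layer is (n) or (n n−1). The cycles, written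
-- from their maxima, partition [n], so θ maps Sₙ to Sₙ, and the cycle of n comes last in θ τ.
-- Hence if σ = θ π and θ σ = π, then σ = A n Q and π = B n O, where n Q is the π-cycle of n and
-- n O the σ-cycle of n. A cycle ends at the preimage of its first element, so Q runs from |A| + 1
-- to |B| + 1 and O from |B| + 1 to |A| + 1. When π avoids 321, O is increasing, and then
-- |A| + |Q| = |B| + |O| forces O to be empty or the single entry n − 1.
module Submission where

open import Defs
open import Data.Bool using (Bool; true; false; if_then_else_; _∧_; _∨_; not)
open import Data.Bool.Properties using (∨-zeroʳ; ∨-assoc; ∨-conicalˡ; ∨-conicalʳ; not-involutive)
open import Data.Empty using (⊥-elim)
open import Data.Fin using (Fin; toℕ; fromℕ<)
import Data.Fin.Properties as Fin
open import Data.List using (List; []; _∷_; _++_; _∷ʳ_; [_]; length; map; concat; concatMap; applyUpTo; iterate; last)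
open import Data.List.Extrema.Nat using (max; argmax-sel; ⊥≤max; xs≤max)
open import Data.List.Membership.Propositional using (_∈_; find; lose)
open import Data.List.Membership.Propositional.Properties
  using (∈-applyUpTo⁺; ∈-applyUpTo⁻; ∈-∃++; ∈-concatMap⁺; ∈-concatMap⁻; ∈-++⁺ˡ; ∈-++⁺ʳ; ∈-++⁻; ∈-map⁺; ∈-map⁻)
open import Data.List.Properties
  using (applyUpTo-∷ʳ; length-applyUpTo; map-cong-local; concatMap-++; ++-identityʳ; ++-assoc; ++-cancelʳ;
         ∷-injectiveˡ; ∷-injectiveʳ; ∷ʳ-injectiveʳ; length-++; length-++-sucʳ; length-map)
open import Data.List.Relation.Binary.Permutation.Propositional
  using (_↭_; prep; swap; ↭-refl; ↭-reflexive; ↭-sym; ↭-trans; ↭⇒↭ₛ)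
open import Data.List.Relation.Binary.Permutation.Propositional.Properties
  using (↭-length; ∈-resp-↭; shift; drop-∷; ++-comm; ++⁺ʳ; ++⁺ˡ; ↭-empty-inv; ↭-singleton-inv)
import Data.List.Relation.Binary.Permutation.Setoid.Properties as ↭ₛ
open import Data.List.Relation.Binary.Subset.Propositional using (_⊆_)
open import Data.List.Relation.Unary.All using (All; []; _∷_)
import Data.List.Relation.Unary.All as All
open import Data.List.Relation.Unary.AllPairs using (AllPairs; []; _∷_)
import Data.List.Relation.Unary.AllPairs as AllPairs
open import Data.List.Relation.Unary.Any using (here; there)
open import Data.List.Relation.Unary.Unique.Propositional using (Unique)
open import Data.List.Relation.Unary.Unique.Propositional.Properties using (applyUpTo⁺₁; ++⁺; map⁺)
open import Data.Maybe using (just)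
open import Data.Maybe.Properties using (just-injective)
open import Data.Nat using (ℕ; zero; suc; pred; _+_; _*_; _∸_; _≤_; _<_; z≤n; s≤s; z<s; s<s; _<ᵇ_; _≡ᵇ_; NonZero)
open import Data.Nat.DivMod using (_%_; _/_; m≡m%n+[m/n]*n; m%n<n)
open import Data.Nat.GeneralisedArithmetic using () renaming (iterate to iter)
open import Data.Nat.Properties
open import Data.Product using (Σ; ∃; _×_; _,_; proj₁; proj₂)
open import Data.Sum using (_⊎_; inj₁; inj₂; [_,_]′)
import Data.Sum as Sum
open import Function using (_∘_; id)
open import Function.Bundles using (_⇔_; mk⇔; Equivalence)
open import Relation.Binary.PropositionalEquality hiding ([_])
open import Relation.Nullary using (¬_; yes; no)
open import Relation.Unary using (Decidable)

≡ᵇ-refl : ∀ n → (n ≡ᵇ n) ≡ true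
≡ᵇ-refl zero = refl
≡ᵇ-refl (suc n) = ≡ᵇ-refl n

≢⇒≡ᵇ≡false : ∀ {m n} → m ≢ n → (m ≡ᵇ n) ≡ false
≢⇒≡ᵇ≡false {zero} {zero} m≢n = ⊥-elim (m≢n refl)
≢⇒≡ᵇ≡false {zero} {suc n} _ = refl
≢⇒≡ᵇ≡false {suc m} {zero} _ = refl
≢⇒≡ᵇ≡false {suc m} {suc n} m≢n = ≢⇒≡ᵇ≡false (m≢n ∘ cong suc)

<⇒<ᵇ≡true : ∀ {m n} → m < n → (m <ᵇ n) ≡ true
<⇒<ᵇ≡true {zero} (s≤s _) = refl
<⇒<ᵇ≡true {suc m} (s≤s m<n) = <⇒<ᵇ≡true m<n

≤⇒<ᵇ≡false : ∀ {m n} → n ≤ m → (m <ᵇ n) ≡ false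
≤⇒<ᵇ≡false {n = zero} _ = refl
≤⇒<ᵇ≡false (s≤s n≤m) = ≤⇒<ᵇ≡false n≤m

<ᵇ≡false⇒≤ : ∀ m n → (m <ᵇ n) ≡ false → n ≤ m
<ᵇ≡false⇒≤ m zero _ = z≤n
<ᵇ≡false⇒≤ (suc m) (suc n) m≮n = s≤s (<ᵇ≡false⇒≤ m n m≮n)

InRange : ℕ → ℕ → Set
InRange n i = 1 ≤ i × i ≤ n

at-∈ : ∀ xs {i} → InRange (length xs) i → at xs i ∈ xs
at-∈ (x ∷ xs) {suc zero} _ = here refl
at-∈ (x ∷ xs) {suc (suc i)} (_ , s≤s i<n) = there (at-∈ xs (s≤s z≤n , i<n))

at-++ˡ : ∀ xs ys {i} → i ≤ length xs → at (xs ++ ys) i ≡ at xs i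
at-++ˡ [] [] {zero} _ = refl
at-++ˡ [] (y ∷ ys) {zero} _ = refl
at-++ˡ (x ∷ xs) ys {zero} _ = refl
at-++ˡ (x ∷ xs) ys {suc zero} _ = refl
at-++ˡ (x ∷ xs) ys {suc (suc i)} (s≤s i<n) = at-++ˡ xs ys i<n

at-++ʳ : ∀ xs ys i → at (xs ++ ys) (suc (i + length xs)) ≡ at ys (suc i)
at-++ʳ [] ys i = cong (at ys ∘ suc) (+-identityʳ i)
at-++ʳ (x ∷ xs) ys i rewrite +-suc i (length xs) = at-++ʳ xs ys i

at-injective : ∀ {xs} → Unique xs → ∀ {i j} → InRange (length xs) i → InRange (length xs) j → at xs i ≡ at xs j → i ≡ j
at-injective {x ∷ xs} _ {suc zero} {suc zero} _ _ _ = refl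
at-injective {x ∷ xs} (x∉ ∷ _) {suc zero} {suc (suc j)} _ (_ , s≤s j<n) x≡ =
  ⊥-elim (All.lookup x∉ (at-∈ xs (s≤s z≤n , j<n)) x≡)
at-injective {x ∷ xs} (x∉ ∷ _) {suc (suc i)} {suc zero} (_ , s≤s i<n) _ ≡x =
  ⊥-elim (All.lookup x∉ (at-∈ xs (s≤s z≤n , i<n)) (sym ≡x))
at-injective {x ∷ xs} (_ ∷ u) {suc (suc i)} {suc (suc j)} (_ , s≤s i<n) (_ , s≤s j<n) eq =
  cong suc (at-injective u (s≤s z≤n , i<n) (s≤s z≤n , j<n) eq)

Unique-resp-↭ : ∀ {A : Set} {xs ys : List A} → xs ↭ ys → Unique xs → Unique ys
Unique-resp-↭ {A} xs↭ys = ↭ₛ.Unique-resp-↭ (setoid A) (↭⇒↭ₛ xs↭ys)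

Unique-suffix : ∀ {A : Set} (B : List A) {xs} → Unique (B ++ xs) → Unique xs
Unique-suffix [] xs! = xs!
Unique-suffix (b ∷ B) (_ ∷ rest!) = Unique-suffix B rest!

∈-∷-≢ : ∀ {A : Set} {x z : A} {xs} → z ∈ x ∷ xs → z ≢ x → z ∈ xs
∈-∷-≢ (here z≡x) z≢x = ⊥-elim (z≢x z≡x)
∈-∷-≢ (there z∈) _ = z∈

unique-⊆⊇⇒↭ : ∀ {A : Set} {xs ys : List A} → Unique xs → Unique ys → xs ⊆ ys → ys ⊆ xs → xs ↭ ys
unique-⊆⊇⇒↭ {xs = []} {[]} _ _ _ _ = ↭-refl
unique-⊆⊇⇒↭ {xs = []} {y ∷ ys} _ _ _ ys⊆[] with () ← ys⊆[] (here refl)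
unique-⊆⊇⇒↭ {xs = x ∷ xs} (x∉xs ∷ xs!) ys! xs⊆ ys⊆ with as , bs , refl ← ∈-∃++ (xs⊆ (here refl)) =
  ↭-trans (prep x (unique-⊆⊇⇒↭ xs! as++bs! ⊆as++bs as++bs⊆)) (↭-sym (shift x as bs))
  where
  x∷as++bs! : Unique (x ∷ as ++ bs)
  x∷as++bs! = Unique-resp-↭ (shift x as bs) ys!
  as++bs! : Unique (as ++ bs)
  as++bs! = AllPairs.tail x∷as++bs!
  ⊆as++bs : xs ⊆ as ++ bs
  ⊆as++bs z∈ = ∈-∷-≢ (∈-resp-↭ (shift x as bs) (xs⊆ (there z∈))) λ { refl → All.lookup x∉xs z∈ refl }
  as++bs⊆ : as ++ bs ⊆ xs
  as++bs⊆ z∈ = ∈-∷-≢ (ys⊆ (∈-resp-↭ (↭-sym (shift x as bs)) (there z∈))) λ { refl → All.lookup (AllPairs.head x∷as++bs!) z∈ refl }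

concatMap-unique : ∀ {A B : Set} (f : A → List B) {xs} → Unique xs → (∀ {x} → x ∈ xs → Unique (f x)) →
                   (∀ {x y z} → x ∈ xs → y ∈ xs → z ∈ f x → z ∈ f y → x ≡ y) → Unique (concatMap f xs)
concatMap-unique f {[]} _ _ _ = []
concatMap-unique f {x ∷ xs} (x∉xs ∷ xs!) f! shared⇒≡ =
  ++⁺ (f! (here refl)) (concatMap-unique f xs! (f! ∘ there) (λ x∈ y∈ → shared⇒≡ (there x∈) (there y∈))) disjoint
  where
  disjoint : ∀ {z} → ¬ (z ∈ f x × z ∈ concatMap f xs)
  disjoint (z∈fx , z∈rest) with y , y∈xs , z∈fy ← find (∈-concatMap⁻ f z∈rest) =
    All.lookup x∉xs y∈xs (shared⇒≡ (here refl) (there y∈xs) z∈fx z∈fy)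

↭-++-cancelˡ : ∀ {A : Set} (zs : List A) {xs ys} → zs ++ xs ↭ zs ++ ys → xs ↭ ys
↭-++-cancelˡ [] p = p
↭-++-cancelˡ (z ∷ zs) p = ↭-++-cancelˡ zs (drop-∷ p)

↭-++-cancelʳ : ∀ {A : Set} (zs : List A) {xs ys} → xs ++ zs ↭ ys ++ zs → xs ↭ ys
↭-++-cancelʳ zs {xs} {ys} p = ↭-++-cancelˡ zs (↭-trans (++-comm zs xs) (↭-trans p (++-comm ys zs)))

length≡0⇒[] : ∀ {A : Set} {xs : List A} → length xs ≡ 0 → xs ≡ []
length≡0⇒[] {xs = []} _ = refl

last-++-∷ : ∀ {A : Set} (xs : List A) y ys → last (xs ++ y ∷ ys) ≡ last (y ∷ ys)
last-++-∷ [] y ys = refl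
last-++-∷ (x ∷ []) y ys = refl
last-++-∷ (x ∷ x′ ∷ xs) y ys = last-++-∷ (x′ ∷ xs) y ys

last≡at-length : ∀ {xs : List ℕ} → 0 < length xs → last xs ≡ just (at xs (length xs))
last≡at-length {x ∷ []} _ = refl
last≡at-length {x ∷ x′ ∷ xs} _ = last≡at-length {x′ ∷ xs} z<s

nonempty : ∀ (xs : List ℕ) y ys → 0 < length (xs ++ y ∷ ys)
nonempty xs y ys = subst (0 <_) (sym (length-++-sucʳ xs y ys)) z<s

sorted-spread : ∀ {x z} xs → AllPairs _<_ (x ∷ xs) → last (x ∷ xs) ≡ just z → x + length xs ≤ z
sorted-spread {x} [] _ refl = ≤-reflexive (+-identityʳ x)
sorted-spread {x} {z} (y ∷ ys) ((x<y ∷ _) ∷ sorted) last≡z = begin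
  x + suc (length ys)  ≡⟨ +-suc x (length ys) ⟩
  suc x + length ys    ≤⟨ +-monoˡ-≤ (length ys) x<y ⟩
  y + length ys        ≤⟨ sorted-spread ys sorted last≡z ⟩
  z                    ∎
  where open ≤-Reasoning

oneTo≡applyUpTo : ∀ n → oneTo n ≡ applyUpTo suc n
oneTo≡applyUpTo zero = refl
oneTo≡applyUpTo (suc n) = trans (cong (_∷ʳ suc n) (oneTo≡applyUpTo n)) (applyUpTo-∷ʳ suc n)

∈-oneTo⁻ : ∀ {n z} → z ∈ oneTo n → InRange n z
∈-oneTo⁻ {n} z∈ with ∈-applyUpTo⁻ suc (subst (_ ∈_) (oneTo≡applyUpTo n) z∈)
... | i , i<n , refl = s≤s z≤n , i<n

∈-oneTo⁺ : ∀ {n z} → InRange n z → z ∈ oneTo n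
∈-oneTo⁺ {n} {suc i} (_ , i<n) = subst (_ ∈_) (sym (oneTo≡applyUpTo n)) (∈-applyUpTo⁺ suc i<n)

oneTo-unique : ∀ n → Unique (oneTo n)
oneTo-unique n = subst Unique (sym (oneTo≡applyUpTo n)) (applyUpTo⁺₁ suc n (λ i<j _ → <⇒≢ i<j ∘ suc-injective))

length-oneTo : ∀ n → length (oneTo n) ≡ n
length-oneTo n = trans (cong length (oneTo≡applyUpTo n)) (length-applyUpTo suc n)

concatMap-oneTo-suc : ∀ {A : Set} (f : ℕ → List A) k → concatMap f (oneTo (suc k)) ≡ concatMap f (oneTo k) ++ f (suc k)
concatMap-oneTo-suc f k = trans (concatMap-++ f (oneTo k) [ suc k ]) (cong (concatMap f (oneTo k) ++_) (++-identityʳ (f (suc k))))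

IsPerm⇒length : ∀ {n π} → IsPerm n π → length π ≡ n
IsPerm⇒length {n} π↭ = trans (↭-length π↭) (length-oneTo n)

IsPerm⇒Unique : ∀ {n π} → IsPerm n π → Unique π
IsPerm⇒Unique {n} π↭ = Unique-resp-↭ (↭-sym π↭) (oneTo-unique n)

IsPerm⇒nonempty : ∀ {n τ m} → IsPerm n τ → InRange n m → 0 < length τ
IsPerm⇒nonempty {n} τ-perm (1≤m , m≤n) = subst (0 <_) (sym (IsPerm⇒length {n} τ-perm)) (≤-trans 1≤m m≤n)

at-above : ∀ {k} P ys i → IsPerm k P → at (P ++ ys) (suc (i + k)) ≡ at ys (suc i)
at-above {k} P ys i P-perm = subst (λ l → at (P ++ ys) (suc (i + l)) ≡ at ys (suc i)) (IsPerm⇒length {k} P-perm) (at-++ʳ P ys i)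

-- Orbits of a permutation of [1, n]

iter-suc : ∀ {A : Set} (g : A → A) x i → iter g x (suc i) ≡ g (iter g x i)
iter-suc g x zero = refl
iter-suc g x (suc i) = iter-suc g (g x) i

iter-+ : ∀ {A : Set} (g : A → A) x i j → iter g x (i + j) ≡ iter g (iter g x i) j
iter-+ g x zero j = refl
iter-+ g x (suc i) j = iter-+ g (g x) i j

iter-periodic : ∀ {A : Set} (g : A → A) {x p} → iter g x p ≡ x → ∀ k → iter g x (k * p) ≡ x
iter-periodic g ret zero = refl
iter-periodic g {x} {p} ret (suc k) = begin
  iter g x (p + k * p)          ≡⟨ iter-+ g x p (k * p) ⟩
  iter g (iter g x p) (k * p)   ≡⟨ cong (λ y → iter g y (k * p)) ret ⟩
  iter g x (k * p)              ≡⟨ iter-periodic g ret k ⟩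
  x                             ∎
  where open ≡-Reasoning

iter-% : ∀ {A : Set} (g : A → A) {x p} .{{_ : NonZero p}} → iter g x p ≡ x → ∀ i → iter g x i ≡ iter g x (i % p)
iter-% g {x} {p} ret i = begin
  iter g x i                              ≡⟨ cong (iter g x) (trans (m≡m%n+[m/n]*n i p) (+-comm (i % p) _)) ⟩
  iter g x (i / p * p + i % p)            ≡⟨ iter-+ g x (i / p * p) (i % p) ⟩
  iter g (iter g x (i / p * p)) (i % p)   ≡⟨ cong (λ y → iter g y (i % p)) (iter-periodic g ret (i / p)) ⟩
  iter g x (i % p)                        ∎
  where open ≡-Reasoning

iterate≡applyUpTo : ∀ {A : Set} (g : A → A) x p → iterate g x p ≡ applyUpTo (iter g x) p
iterate≡applyUpTo g x zero = refl
iterate≡applyUpTo g x (suc p) = cong (x ∷_) (iterate≡applyUpTo g (g x) p)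

∈-iterate⁻ : ∀ {A : Set} (g : A → A) {x p y} → y ∈ iterate g x p → ∃ λ i → i < p × iter g x i ≡ y
∈-iterate⁻ g {x} {p} y∈ with ∈-applyUpTo⁻ (iter g x) (subst (_ ∈_) (iterate≡applyUpTo g x p) y∈)
... | i , i<p , y≡ = i , i<p , sym y≡

∈-iterate⁺ : ∀ {A : Set} (g : A → A) {x p i} → i < p → iter g x i ∈ iterate g x p
∈-iterate⁺ g {x} {p} i<p = subst (_ ∈_) (sym (iterate≡applyUpTo g x p)) (∈-applyUpTo⁺ (iter g x) i<p)

iterate-∷ʳ : ∀ {A : Set} (g : A → A) x p → iterate g x (suc p) ≡ iterate g x p ∷ʳ iter g x p
iterate-∷ʳ g x p = begin
  iterate g x (suc p)                  ≡⟨ iterate≡applyUpTo g x (suc p) ⟩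
  applyUpTo (iter g x) (suc p)         ≡⟨ sym (applyUpTo-∷ʳ (iter g x) p) ⟩
  applyUpTo (iter g x) p ∷ʳ iter g x p ≡⟨ cong (_∷ʳ iter g x p) (sym (iterate≡applyUpTo g x p)) ⟩
  iterate g x p ∷ʳ iter g x p          ∎
  where open ≡-Reasoning

minimise : ∀ {P : ℕ → Set} → Decidable P → ∀ {e} → P e → ∃ λ d → d ≤ e × P d × (∀ {i} → i < d → ¬ P i)
minimise P? {zero} pe = 0 , z≤n , pe , λ ()
minimise P? {suc e} pe with P? 0
... | yes p0 = 0 , z≤n , p0 , λ ()
... | no ¬p0 with minimise (P? ∘ suc) {e} pe
...   | d , d≤e , pd , below = suc d , s≤s d≤e , pd , λ { {zero} _ → ¬p0 ; {suc i} (s≤s i<d) → below i<d }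

record Permutes (n : ℕ) (g : ℕ → ℕ) : Set where
  field
    maps-to   : ∀ {i} → InRange n i → InRange n (g i)
    injective : ∀ {i j} → InRange n i → InRange n j → g i ≡ g j → i ≡ j

record LeastPeriod {A : Set} (g : A → A) (x : A) (p : ℕ) : Set where
  field
    returns : iter g x p ≡ x
    least   : ∀ {i} → 0 < i → i < p → iter g x i ≢ x

Reaches : ∀ {A : Set} → (A → A) → A → A → Set
Reaches g x y = ∃ λ i → iter g x i ≡ y

reaches-trans : ∀ {A : Set} (g : A → A) {x y z} → Reaches g x y → Reaches g y z → Reaches g x z
reaches-trans g {x} (i , refl) (j , refl) = i + j , iter-+ g x i j

module Orbits {n : ℕ} {g : ℕ → ℕ} (g-perm : Permutes n g) where
  open Permutes g-perm

  iter-maps-to : ∀ i {x} → InRange n x → InRange n (iter g x i)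
  iter-maps-to zero x∈ = x∈
  iter-maps-to (suc i) x∈ = iter-maps-to i (maps-to x∈)

  iter-injective : ∀ i {x y} → InRange n x → InRange n y → iter g x i ≡ iter g y i → x ≡ y
  iter-injective zero _ _ eq = eq
  iter-injective (suc i) x∈ y∈ eq = injective x∈ y∈ (iter-injective i (maps-to x∈) (maps-to y∈) eq)

  private
    index : ∀ {y} → InRange n y → Fin n
    index {suc y} (_ , y<n) = fromℕ< y<n

    index-injective : ∀ {y z} (y∈ : InRange n y) (z∈ : InRange n z) → index y∈ ≡ index z∈ → y ≡ z
    index-injective {suc y} {suc z} _ _ eq = cong suc (Fin.fromℕ<-injective y z _ _ eq)

  returns-within : ∀ {x} → InRange n x → ∃ λ p → 0 < p × p ≤ n × iter g x p ≡ x
  returns-within {x} x∈ with Fin.pigeonhole (n<1+n n) (λ i → index (iter-maps-to (toℕ i) x∈))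
  ... | i , j , i<j , same = toℕ j ∸ toℕ i , m<n⇒0<n∸m i<j , ≤-trans (m∸n≤m (toℕ j) (toℕ i)) (Fin.toℕ≤pred[n] j) , returns
    where
    returns : iter g x (toℕ j ∸ toℕ i) ≡ x
    returns = sym (iter-injective (toℕ i) x∈ (iter-maps-to (toℕ j ∸ toℕ i) x∈) (begin
      iter g x (toℕ i)                               ≡⟨ index-injective _ _ same ⟩
      iter g x (toℕ j)                               ≡⟨ cong (iter g x) (sym (m∸n+n≡m (<⇒≤ i<j))) ⟩
      iter g x (toℕ j ∸ toℕ i + toℕ i)               ≡⟨ iter-+ g x (toℕ j ∸ toℕ i) (toℕ i) ⟩
      iter g (iter g x (toℕ j ∸ toℕ i)) (toℕ i)      ∎))
      where open ≡-Reasoning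

  leastPeriod : ∀ {x} → InRange n x → ∃ λ q → suc q ≤ n × LeastPeriod g x (suc q)
  leastPeriod {x} x∈ with returns-within x∈
  ... | suc e , _ , p≤n , ret with minimise (λ i → iter g x (suc i) ≟ x) {e} ret
  ...   | q , q≤e , ret′ , below = q , ≤-trans (s≤s q≤e) p≤n ,
          record { returns = ret′ ; least = λ { {suc i} _ (s≤s i<q) → below i<q } }

  module _ {x p} .{{_ : NonZero p}} (x∈ : InRange n x) (period : LeastPeriod g x p) where
    open LeastPeriod period

    reaches⇒∈-iterate : ∀ {y} → Reaches g x y → y ∈ iterate g x p
    reaches⇒∈-iterate (i , refl) = subst (_∈ iterate g x p) (sym (iter-% g returns i)) (∈-iterate⁺ g (m%n<n i p))

    reaches-sym : ∀ {y} → Reaches g x y → Reaches g y x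
    reaches-sym (i , refl) = p ∸ i % p , (begin
      iter g (iter g x i) (p ∸ i % p)          ≡⟨ cong (λ y → iter g y (p ∸ i % p)) (iter-% g returns i) ⟩
      iter g (iter g x (i % p)) (p ∸ i % p)    ≡⟨ sym (iter-+ g x (i % p) (p ∸ i % p)) ⟩
      iter g x (i % p + (p ∸ i % p))           ≡⟨ cong (iter g x) (m+[n∸m]≡n (<⇒≤ (m%n<n i p))) ⟩
      iter g x p                               ≡⟨ returns ⟩
      x                                        ∎)
      where open ≡-Reasoning

    iterate-unique : Unique (iterate g x p)
    iterate-unique = subst Unique (sym (iterate≡applyUpTo g x p)) (applyUpTo⁺₁ (iter g x) p distinct)
      where
      distinct : ∀ {i j} → i < j → j < p → iter g x i ≢ iter g x j
      distinct {i} {j} i<j j<p eq = least (m<n⇒0<n∸m i<j) (≤-<-trans (m∸n≤m j i) j<p)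
        (sym (iter-injective i x∈ (iter-maps-to (j ∸ i) x∈) (begin
          iter g x i                      ≡⟨ eq ⟩
          iter g x j                      ≡⟨ cong (iter g x) (sym (m∸n+n≡m (<⇒≤ i<j))) ⟩
          iter g x (j ∸ i + i)            ≡⟨ iter-+ g x (j ∸ i) i ⟩
          iter g (iter g x (j ∸ i)) i     ∎)))
        where open ≡-Reasoning

  module _ (τ : List ℕ) (τ≗g : ∀ {x} → InRange n x → at τ x ≡ g x) where

    orbitFrom-iterate : ∀ {m y f} q → InRange n y → q ≤ f → iter g y q ≡ m → (∀ {i} → i < q → iter g y i ≢ m) →
                        orbitFrom τ m f y ≡ iterate g y q
    orbitFrom-iterate {f = zero} zero _ _ _ _ = refl
    orbitFrom-iterate {m} {f = suc f} zero _ _ refl _ rewrite ≡ᵇ-refl m = refl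
    orbitFrom-iterate {m} {y} {suc f} (suc q) y∈ (s≤s q≤f) ret avoids
      rewrite ≢⇒≡ᵇ≡false (avoids z<s) | τ≗g y∈ =
        cong (y ∷_) (orbitFrom-iterate q (maps-to y∈) q≤f ret (avoids ∘ s<s))

    cycleOf-iterate : ∀ {x q} → InRange n x → q ≤ length τ → LeastPeriod g x (suc q) → cycleOf τ x ≡ iterate g x (suc q)
    cycleOf-iterate {x} {q} x∈ q≤ period = cong (x ∷_) (begin
      orbitFrom τ x (length τ) (at τ x)   ≡⟨ cong (orbitFrom τ x (length τ)) (τ≗g x∈) ⟩
      orbitFrom τ x (length τ) (g x)      ≡⟨ orbitFrom-iterate q (maps-to x∈) q≤ returns (λ i<q → least z<s (s<s i<q)) ⟩
      iterate g (g x) q                   ∎)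
      where
      open ≡-Reasoning
      open LeastPeriod period

IsPerm⇒Permutes : ∀ {n π} → IsPerm n π → Permutes n (at π)
IsPerm⇒Permutes {n} {π} π↭ = record
  { maps-to   = λ i∈ → ∈-oneTo⁻ (∈-resp-↭ π↭ (at-∈ π (resize i∈)))
  ; injective = λ i∈ j∈ → at-injective (IsPerm⇒Unique {n} π↭) (resize i∈) (resize j∈)
  }
  where
  resize : ∀ {i} → InRange n i → InRange (length π) i
  resize (1≤i , i≤n) = 1≤i , subst (_ ≤_) (sym (IsPerm⇒length {n} π↭)) i≤n

-- Cycles and the map θ

anyGreater≡false⁺ : ∀ {m} xs → All (_≤ m) xs → anyGreater m xs ≡ false
anyGreater≡false⁺ [] [] = refl
anyGreater≡false⁺ (x ∷ xs) (x≤m ∷ xs≤m) rewrite ≤⇒<ᵇ≡false x≤m = anyGreater≡false⁺ xs xs≤m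

anyGreater≡false⁻ : ∀ {m} xs → anyGreater m xs ≡ false → All (_≤ m) xs
anyGreater≡false⁻ [] _ = []
anyGreater≡false⁻ {m} (x ∷ xs) none = <ᵇ≡false⇒≤ m x (∨-conicalˡ _ _ none) ∷ anyGreater≡false⁻ xs (∨-conicalʳ _ _ none)

anyGreater≡true : ∀ {m y} xs → y ∈ xs → m < y → anyGreater m xs ≡ true
anyGreater≡true (x ∷ xs) (here refl) m<x rewrite <⇒<ᵇ≡true m<x = refl
anyGreater≡true {m} (x ∷ xs) (there y∈) m<y rewrite anyGreater≡true xs y∈ m<y = ∨-zeroʳ (m <ᵇ x)

isCycleMax⁺ : ∀ τ m → All (_≤ m) (cycleOf τ m) → isCycleMax τ m ≡ true
isCycleMax⁺ τ m ≤m = cong not (anyGreater≡false⁺ (cycleOf τ m) ≤m)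

isCycleMax⁻ : ∀ τ m → isCycleMax τ m ≡ true → All (_≤ m) (cycleOf τ m)
isCycleMax⁻ τ m max = anyGreater≡false⁻ (cycleOf τ m) (trans (sym (not-involutive _)) (cong not max))

block : List ℕ → ℕ → List ℕ
block τ m = if isCycleMax τ m then cycleOf τ m else []

∈-block⁻ : ∀ τ m {y} → y ∈ block τ m → isCycleMax τ m ≡ true × y ∈ cycleOf τ m
∈-block⁻ τ m y∈ with isCycleMax τ m
... | true = refl , y∈

block-max : ∀ τ m → isCycleMax τ m ≡ true → block τ m ≡ cycleOf τ m
block-max τ m max rewrite max = refl

block-nonmax : ∀ τ m {y} → y ∈ cycleOf τ m → m < y → block τ m ≡ []
block-nonmax τ m y∈ m<y rewrite anyGreater≡true (cycleOf τ m) y∈ m<y = refl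

cycleOf-fixed : ∀ τ {m} → 0 < length τ → at τ m ≡ m → cycleOf τ m ≡ [ m ]
cycleOf-fixed (x ∷ xs) {m} _ fixed rewrite fixed | ≡ᵇ-refl m = refl

cycleOf-moved : ∀ τ {m} → 0 < length τ → at τ m ≢ m → ∃ λ rest → cycleOf τ m ≡ m ∷ at τ m ∷ rest
cycleOf-moved (x ∷ xs) _ moved rewrite ≢⇒≡ᵇ≡false moved = _ , refl

cycleOf-transposed : ∀ τ {f m x} → length τ ≡ suc (suc f) → at τ m ≡ x → at τ x ≡ m → x ≢ m → cycleOf τ m ≡ m ∷ x ∷ []
cycleOf-transposed τ {m = m} len m↦x x↦m x≢m rewrite len | m↦x | ≢⇒≡ᵇ≡false x≢m | x↦m | ≡ᵇ-refl m = refl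

module Cycles {n : ℕ} (τ : List ℕ) (τ-perm : IsPerm n τ) where
  private
    τ-permutes : Permutes n (at τ)
    τ-permutes = IsPerm⇒Permutes τ-perm
  open Orbits τ-permutes public

  cycle : ∀ {x} → InRange n x → ∃ λ q → LeastPeriod (at τ) x (suc q) × cycleOf τ x ≡ iterate (at τ) x (suc q)
  cycle x∈ with q , p≤n , period ← leastPeriod x∈ =
    q , period , cycleOf-iterate τ (λ _ → refl) x∈ (≤-trans (n≤1+n q) (≤-trans p≤n (≤-reflexive (sym (IsPerm⇒length τ-perm))))) period

  ∈-cycleOf⁻ : ∀ {x y} → InRange n x → y ∈ cycleOf τ x → Reaches (at τ) x y
  ∈-cycleOf⁻ {y = y} x∈ y∈ with q , _ , c≡ ← cycle x∈ with i , _ , y≡ ← ∈-iterate⁻ (at τ) (subst (y ∈_) c≡ y∈) = i , y≡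

  ∈-cycleOf⁺ : ∀ {x y} → InRange n x → Reaches (at τ) x y → y ∈ cycleOf τ x
  ∈-cycleOf⁺ {y = y} x∈ x↝y with q , period , c≡ ← cycle x∈ = subst (y ∈_) (sym c≡) (reaches⇒∈-iterate x∈ period x↝y)

  cycleOf-unique : ∀ {x} → InRange n x → Unique (cycleOf τ x)
  cycleOf-unique x∈ with q , period , c≡ ← cycle x∈ = subst Unique (sym c≡) (iterate-unique x∈ period)

  reaches-symmetric : ∀ {x y} → InRange n x → Reaches (at τ) x y → Reaches (at τ) y x
  reaches-symmetric x∈ x↝y with q , period , _ ← cycle x∈ = reaches-sym x∈ period x↝y

  cycleOf⊆range : ∀ {x y} → InRange n x → y ∈ cycleOf τ x → InRange n y
  cycleOf⊆range x∈ y∈ with i , refl ← ∈-cycleOf⁻ x∈ y∈ = iter-maps-to i x∈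

  θ≡concatMap-block : θ τ ≡ concatMap (block τ) (oneTo n)
  θ≡concatMap-block = cong (concatMap (block τ) ∘ oneTo) (IsPerm⇒length {n} τ-perm)

  cycle-max-bound : ∀ {a b z} → InRange n a → InRange n b → isCycleMax τ a ≡ true →
                    z ∈ cycleOf τ a → z ∈ cycleOf τ b → b ≤ a
  cycle-max-bound a∈ b∈ a-max z∈a z∈b = All.lookup (isCycleMax⁻ τ _ a-max)
    (∈-cycleOf⁺ a∈ (reaches-trans (at τ) (∈-cycleOf⁻ a∈ z∈a) (reaches-symmetric b∈ (∈-cycleOf⁻ b∈ z∈b))))

  θ-unique : Unique (θ τ)
  θ-unique = subst Unique (sym θ≡concatMap-block) (concatMap-unique (block τ) (oneTo-unique n) block-unique shared⇒≡)
    where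
    block-unique : ∀ {m} → m ∈ oneTo n → Unique (block τ m)
    block-unique {m} m∈ with isCycleMax τ m
    ... | true = cycleOf-unique (∈-oneTo⁻ m∈)
    ... | false = []
    shared⇒≡ : ∀ {a b z} → a ∈ oneTo n → b ∈ oneTo n → z ∈ block τ a → z ∈ block τ b → a ≡ b
    shared⇒≡ {a} {b} a∈ b∈ z∈a z∈b with a-max , z∈ca ← ∈-block⁻ τ a z∈a | b-max , z∈cb ← ∈-block⁻ τ b z∈b =
      ≤-antisym (cycle-max-bound (∈-oneTo⁻ b∈) (∈-oneTo⁻ a∈) b-max z∈cb z∈ca)
                (cycle-max-bound (∈-oneTo⁻ a∈) (∈-oneTo⁻ b∈) a-max z∈ca z∈cb)

  θ⊆oneTo : θ τ ⊆ oneTo n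
  θ⊆oneTo {z} z∈ with m , m∈ , z∈b ← find (∈-concatMap⁻ (block τ) (subst (z ∈_) θ≡concatMap-block z∈)) =
    ∈-oneTo⁺ (cycleOf⊆range (∈-oneTo⁻ m∈) (proj₂ (∈-block⁻ τ m z∈b)))

  oneTo⊆θ : oneTo n ⊆ θ τ
  oneTo⊆θ {z} z∈ = subst (z ∈_) (sym θ≡concatMap-block) (∈-concatMap⁺ (block τ) (lose (∈-oneTo⁺ M-range) z∈block))
    where
    z-range : InRange n z
    z-range = ∈-oneTo⁻ z∈
    orbit : List ℕ
    orbit = orbitFrom τ z (length τ) (at τ z)
    M : ℕ
    M = max z orbit
    M∈ : M ∈ cycleOf τ z
    M∈ = [ here , there ]′ (argmax-sel id z orbit)
    ≤M : All (_≤ M) (cycleOf τ z)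
    ≤M = ⊥≤max z orbit ∷ xs≤max z orbit
    M-range : InRange n M
    M-range = cycleOf⊆range z-range M∈
    z↝M : Reaches (at τ) z M
    z↝M = ∈-cycleOf⁻ z-range M∈
    M-max : isCycleMax τ M ≡ true
    M-max = isCycleMax⁺ τ M (All.tabulate λ w∈ → All.lookup ≤M (∈-cycleOf⁺ z-range (reaches-trans (at τ) z↝M (∈-cycleOf⁻ M-range w∈))))
    z∈block : z ∈ block τ M
    z∈block = subst (z ∈_) (sym (block-max τ M M-max)) (∈-cycleOf⁺ M-range (reaches-symmetric z-range z↝M))

  θ-IsPerm : IsPerm n (θ τ)
  θ-IsPerm = unique-⊆⊇⇒↭ θ-unique (oneTo-unique n) θ⊆oneTo oneTo⊆θ

θ-ends-with-cycle-of-max : ∀ {k} τ → IsPerm (suc k) τ → θ τ ≡ concatMap (block τ) (oneTo k) ++ cycleOf τ (suc k)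
θ-ends-with-cycle-of-max {k} τ τ-perm = begin
  θ τ                                                 ≡⟨ θ≡concatMap-block ⟩
  concatMap (block τ) (oneTo (suc k))                 ≡⟨ concatMap-oneTo-suc (block τ) k ⟩
  concatMap (block τ) (oneTo k) ++ block τ (suc k)    ≡⟨ cong (concatMap (block τ) (oneTo k) ++_) (block-max τ (suc k) top-max) ⟩
  concatMap (block τ) (oneTo k) ++ cycleOf τ (suc k)  ∎
  where
  open ≡-Reasoning
  open Cycles τ τ-perm
  top-max : isCycleMax τ (suc k) ≡ true
  top-max = isCycleMax⁺ τ (suc k) (All.tabulate (proj₂ ∘ cycleOf⊆range (s≤s z≤n , ≤-refl)))

last-cycleOf : ∀ {n} τ → IsPerm n τ → ∀ {m y} → InRange n m → InRange n y → at τ y ≡ m → last (cycleOf τ m) ≡ just y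
last-cycleOf {n} τ τ-perm {m} {y} m∈ y∈ y↦m with q , period , c≡ ← Cycles.cycle {n} τ τ-perm m∈ = begin
  last (cycleOf τ m)                         ≡⟨ cong last (trans c≡ (iterate-∷ʳ (at τ) m q)) ⟩
  last (iterate (at τ) m q ++ [ iter (at τ) m q ]) ≡⟨ last-++-∷ (iterate (at τ) m q) _ [] ⟩
  just (iter (at τ) m q)                     ≡⟨ cong just (injective (iter-maps-to q m∈) y∈ (trans (sym (iter-suc (at τ) m q)) (trans returns (sym y↦m)))) ⟩
  just y                                     ∎
  where
  open ≡-Reasoning
  open Cycles {n} τ τ-perm
  open Permutes (IsPerm⇒Permutes {n} τ-perm)
  open LeastPeriod period

second-of-cycle : ∀ {n} τ {m x xs} → IsPerm n τ → InRange n m → cycleOf τ m ≡ m ∷ x ∷ xs → x ≡ at τ m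
second-of-cycle {n} τ {m} τ-perm m∈ c≡ with at τ m ≟ m
... | yes fixed with () ← ∷-injectiveʳ (trans (sym (cycleOf-fixed τ (IsPerm⇒nonempty τ-perm m∈) fixed)) c≡)
... | no moved with rest , c≡′ ← cycleOf-moved τ (IsPerm⇒nonempty τ-perm m∈) moved = ∷-injectiveˡ (∷-injectiveʳ (trans (sym c≡) c≡′))

-- The cycle of the maximum

position-of-max : ∀ {N τ} C {D} → IsPerm N τ → τ ≡ C ++ N ∷ D →
                  InRange N (suc (length C)) × at τ (suc (length C)) ≡ N × suc (length C + length D) ≡ N
position-of-max {N} C {D} τ-perm refl = (s≤s z≤n , subst (suc (length C) ≤_) len (s≤s (m≤m+n (length C) (length D)))) ,
                                        at-++ʳ C (N ∷ D) 0 , len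
  where
  len : suc (length C + length D) ≡ N
  len = trans (cong suc (sym (length-++ C))) (trans (sym (length-++-sucʳ C N D)) (IsPerm⇒length {N} τ-perm))

last-entry : ∀ {N τ} C {D} → IsPerm N τ → τ ≡ C ++ N ∷ D → last (N ∷ D) ≡ just (at τ N)
last-entry {N} C {D} τ-perm refl = begin
  last (N ∷ D)                                  ≡⟨ sym (last-++-∷ C N D) ⟩
  last (C ++ N ∷ D)                             ≡⟨ last≡at-length {C ++ N ∷ D} (nonempty C N D) ⟩
  just (at (C ++ N ∷ D) (length (C ++ N ∷ D)))  ≡⟨ cong (just ∘ at (C ++ N ∷ D)) (IsPerm⇒length {N} τ-perm) ⟩
  just (at (C ++ N ∷ D) N)                      ∎
  where open ≡-Reasoning

entry-at-max : ∀ {N π σ} A B {O Q} → IsPerm N π → IsPerm N σ → π ≡ B ++ N ∷ O → σ ≡ A ++ N ∷ Q →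
               cycleOf π N ≡ N ∷ Q → at σ N ≡ suc (length B)
entry-at-max {N} {π} {σ} A B {Q = Q} π-perm σ-perm π≡ σ≡ cπ with B-range , B↦N , _ ← position-of-max B π-perm π≡ =
  just-injective (begin
    just (at σ N)          ≡⟨ sym (last-entry A σ-perm σ≡) ⟩
    last (N ∷ Q)           ≡⟨ cong last (sym cπ) ⟩
    last (cycleOf π N)     ≡⟨ last-cycleOf π π-perm (≤-trans (proj₁ B-range) (proj₂ B-range) , ≤-refl) B-range B↦N ⟩
    just (suc (length B))  ∎)
  where open ≡-Reasoning

tails-vanish-together : ∀ {N π σ} A B {O} → IsPerm N π → IsPerm N σ → π ≡ B ++ N ∷ O → σ ≡ A ++ [ N ] →
                        cycleOf π N ≡ [ N ] → O ≡ []
tails-vanish-together A B {[]} _ _ _ _ _ = refl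
tails-vanish-together {N} A B {o ∷ O′} π-perm σ-perm π≡ σ≡ cπ =
  ⊥-elim (m+1+n≢m (length B) (suc-injective (trans lenπ N≡1+b)))
  where
  lenπ : suc (length B + length (o ∷ O′)) ≡ N
  lenπ = proj₂ (proj₂ (position-of-max B π-perm π≡))
  N≡1+b : N ≡ suc (length B)
  N≡1+b = trans (just-injective (last-entry A σ-perm σ≡)) (entry-at-max A B π-perm σ-perm π≡ σ≡ cπ)

balanced-excess : ∀ a b q o → a + q ≡ b + o → b + o ≤ a → q ≡ 0
balanced-excess a b q o a+q≡b+o b+o≤a =
  n≤0⇒n≡0 (+-cancelˡ-≤ a q 0 (≤-trans (≤-reflexive a+q≡b+o) (≤-trans b+o≤a (≤-reflexive (sym (+-identityʳ a))))))

tail-after-max : ∀ {N π σ} A B {O Q} → IsPerm N π → IsPerm N σ → π ≡ B ++ N ∷ O → σ ≡ A ++ N ∷ Q →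
                 cycleOf π N ≡ N ∷ Q → cycleOf σ N ≡ N ∷ O → AllPairs _<_ O → O ≡ [] ⊎ O ≡ [ pred N ]
tail-after-max A B {[]} _ _ _ _ _ _ _ = inj₁ refl
tail-after-max A B {o ∷ O′} {[]} π-perm σ-perm π≡ σ≡ cπ cσ _
  with () ← tails-vanish-together A B π-perm σ-perm π≡ σ≡ cπ
tail-after-max {N} {π} {σ} A B {o ∷ O′} {x ∷ Q′} π-perm σ-perm π≡ σ≡ cπ cσ sorted
  with B-range , B↦N , lenπ ← position-of-max B π-perm π≡ | A-range , A↦N , lenσ ← position-of-max A σ-perm σ≡ =
  inj₂ (cong₂ _∷_ o≡pred[N] (length≡0⇒[] |O′|≡0))
  where
  a b : ℕ
  a = length A
  b = length B
  N-range : InRange N N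
  N-range = ≤-trans (proj₁ B-range) (proj₂ B-range) , ≤-refl
  o≡1+b : o ≡ suc b
  o≡1+b = trans (second-of-cycle σ σ-perm N-range cσ) (entry-at-max A B π-perm σ-perm π≡ σ≡ cπ)
  x≡1+a : x ≡ suc a
  x≡1+a = trans (second-of-cycle π π-perm N-range cπ) (entry-at-max B A σ-perm π-perm σ≡ π≡ cσ)
  lengths : a + length Q′ ≡ b + length O′
  lengths = suc-injective (trans (sym (+-suc a _)) (trans (suc-injective (trans lenσ (sym lenπ))) (+-suc b _)))
  spread : b + length O′ ≤ a
  spread = ≤-pred (subst (λ o → o + length O′ ≤ suc a) o≡1+b
             (sorted-spread O′ sorted (trans (cong last (sym cσ)) (last-cycleOf σ σ-perm N-range A-range A↦N))))
  |Q′|≡0 : length Q′ ≡ 0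
  |Q′|≡0 = balanced-excess a b _ _ lengths spread
  a≡b : a ≡ b
  a≡b = suc-injective (trans (sym x≡1+a) (just-injective (begin
    just x                ≡⟨ cong (λ Q′ → last (N ∷ x ∷ Q′)) (sym (length≡0⇒[] {xs = Q′} |Q′|≡0)) ⟩
    last (N ∷ x ∷ Q′)     ≡⟨ cong last (sym cπ) ⟩
    last (cycleOf π N)    ≡⟨ last-cycleOf π π-perm N-range B-range B↦N ⟩
    just (suc b)          ∎)))
    where open ≡-Reasoning
  |O′|≡0 : length O′ ≡ 0
  |O′|≡0 = balanced-excess b a _ _ (sym lengths) (≤-reflexive (trans (cong (a +_) |Q′|≡0) (trans (+-identityʳ a) a≡b)))
  o≡pred[N] : o ≡ pred N
  o≡pred[N] = trans o≡1+b (trans (sym (+-comm b 1)) (cong pred (trans (cong (λ l → suc (b + suc l)) (sym |O′|≡0)) lenπ)))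

-- 321-avoidance

-- Public copies of the private helpers of contains321; contains321-∷ identifies them with the
-- originals, which can only be reached by unification against their defining equations.
anyLess′ : ℕ → List ℕ → Bool
anyLess′ b [] = false
anyLess′ b (c ∷ cs) = (c <ᵇ b) ∨ anyLess′ b cs

any21′ : ℕ → List ℕ → Bool
any21′ a [] = false
any21′ a (b ∷ bs) = ((b <ᵇ a) ∧ anyLess′ b bs) ∨ any21′ a bs

any21-unique : (less any21 : ℕ → List ℕ → Bool) →
  (∀ b → less b [] ≡ false) → (∀ b c cs → less b (c ∷ cs) ≡ (c <ᵇ b) ∨ less b cs) →
  (∀ a → any21 a [] ≡ false) → (∀ a b bs → any21 a (b ∷ bs) ≡ ((b <ᵇ a) ∧ less b bs) ∨ any21 a bs) →
  ∀ a bs → any21 a bs ≡ any21′ a bs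
any21-unique less any21 less-[] less-∷ any21-[] any21-∷ a [] = any21-[] a
any21-unique less any21 less-[] less-∷ any21-[] any21-∷ a (b ∷ bs) = begin
  any21 a (b ∷ bs)                             ≡⟨ any21-∷ a b bs ⟩
  ((b <ᵇ a) ∧ less b bs) ∨ any21 a bs          ≡⟨ cong₂ (λ l r → ((b <ᵇ a) ∧ l) ∨ r) (less-unique bs)
                                                    (any21-unique less any21 less-[] less-∷ any21-[] any21-∷ a bs) ⟩
  ((b <ᵇ a) ∧ anyLess′ b bs) ∨ any21′ a bs     ∎
  where
  open ≡-Reasoning
  less-unique : ∀ cs → less b cs ≡ anyLess′ b cs
  less-unique [] = less-[] b
  less-unique (c ∷ cs) = trans (less-∷ b c cs) (cong ((c <ᵇ b) ∨_) (less-unique cs))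

contains321-∷ : ∀ a as → contains321 (a ∷ as) ≡ any21′ a as ∨ contains321 as
contains321-∷ = transfer _ (λ _ _ → refl) (any21-unique _ _ (λ _ → refl) (λ _ _ _ → refl) (λ _ → refl) (λ _ _ _ → refl))
  where
  transfer : (any21 : ℕ → List ℕ → Bool) → (∀ a as → contains321 (a ∷ as) ≡ any21 a as ∨ contains321 as) →
             (∀ a as → any21 a as ≡ any21′ a as) → ∀ a as → contains321 (a ∷ as) ≡ any21′ a as ∨ contains321 as
  transfer any21 unfold agree a as = trans (unfold a as) (cong (_∨ contains321 as) (agree a as))

Below : List ℕ → List ℕ → Set
Below P S = All (λ x → All (x ≤_) S) P

anyLess′≡false⁺ : ∀ {b} S → All (b ≤_) S → anyLess′ b S ≡ false
anyLess′≡false⁺ [] [] = refl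
anyLess′≡false⁺ (c ∷ S) (b≤c ∷ b≤S) rewrite ≤⇒<ᵇ≡false b≤c = anyLess′≡false⁺ S b≤S

anyLess′≡false⁻ : ∀ {b} S → anyLess′ b S ≡ false → All (b ≤_) S
anyLess′≡false⁻ [] _ = []
anyLess′≡false⁻ {b} (c ∷ S) none = <ᵇ≡false⇒≤ c b (∨-conicalˡ _ _ none) ∷ anyLess′≡false⁻ S (∨-conicalʳ _ _ none)

any21′≡false⁺ : ∀ {a} S → All (a ≤_) S → any21′ a S ≡ false
any21′≡false⁺ [] [] = refl
any21′≡false⁺ (b ∷ S) (a≤b ∷ a≤S) rewrite ≤⇒<ᵇ≡false a≤b = any21′≡false⁺ S a≤S

anyLess′-++ : ∀ {b} P {S} → All (b ≤_) S → anyLess′ b (P ++ S) ≡ anyLess′ b P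
anyLess′-++ [] b≤S = anyLess′≡false⁺ _ b≤S
anyLess′-++ {b} (c ∷ P) b≤S = cong ((c <ᵇ b) ∨_) (anyLess′-++ P b≤S)

any21′-++ : ∀ {a} P {S} → All (a ≤_) S → Below P S → any21′ a (P ++ S) ≡ any21′ a P
any21′-++ [] a≤S [] = any21′≡false⁺ _ a≤S
any21′-++ {a} (b ∷ P) a≤S (b≤S ∷ P≤S) =
  cong₂ (λ l r → ((b <ᵇ a) ∧ l) ∨ r) (anyLess′-++ P b≤S) (any21′-++ P a≤S P≤S)

contains321-++ : ∀ P {S} → Below P S → contains321 (P ++ S) ≡ contains321 P ∨ contains321 S
contains321-++ [] [] = refl
contains321-++ (a ∷ P) {S} (a≤S ∷ P≤S) = begin
  contains321 (a ∷ P ++ S)                              ≡⟨ contains321-∷ a (P ++ S) ⟩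
  any21′ a (P ++ S) ∨ contains321 (P ++ S)              ≡⟨ cong₂ _∨_ (any21′-++ P a≤S P≤S) (contains321-++ P P≤S) ⟩
  any21′ a P ∨ (contains321 P ∨ contains321 S)          ≡⟨ sym (∨-assoc (any21′ a P) _ _) ⟩
  (any21′ a P ∨ contains321 P) ∨ contains321 S          ≡⟨ cong (_∨ contains321 S) (sym (contains321-∷ a P)) ⟩
  contains321 (a ∷ P) ∨ contains321 S                   ∎
  where open ≡-Reasoning

Avoids321-suffix : ∀ B {xs} → Avoids321 (B ++ xs) → Avoids321 xs
Avoids321-suffix [] avoids = avoids
Avoids321-suffix (b ∷ B) avoids = Avoids321-suffix B (∨-conicalʳ _ _ avoids)

Avoids321-below-first⇒sorted : ∀ {N} O → Avoids321 (N ∷ O) → All (_< N) O → Unique O → AllPairs _<_ O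
Avoids321-below-first⇒sorted [] _ _ _ = []
Avoids321-below-first⇒sorted {N} (c ∷ cs) avoids (c<N ∷ cs<N) (c∉cs ∷ cs!) =
  All.map (λ (c≤x , c≢x) → ≤∧≢⇒< c≤x c≢x) (All.zip (c≤cs , c∉cs)) ∷ Avoids321-below-first⇒sorted cs avoids′ cs<N cs!
  where
  parts : any21′ N (c ∷ cs) ∨ contains321 (c ∷ cs) ≡ false
  parts = trans (sym (contains321-∷ N (c ∷ cs))) avoids
  first : ((c <ᵇ N) ∧ anyLess′ c cs) ∨ any21′ N cs ≡ false
  first = ∨-conicalˡ _ (contains321 (c ∷ cs)) parts
  rest : Avoids321 (c ∷ cs)
  rest = ∨-conicalʳ (any21′ N (c ∷ cs)) _ parts
  c≤cs : All (c ≤_) cs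
  c≤cs = anyLess′≡false⁻ cs (subst (λ t → t ∧ anyLess′ c cs ≡ false) (<⇒<ᵇ≡true c<N) (∨-conicalˡ _ (any21′ N cs) first))
  avoids′ : Avoids321 (N ∷ cs)
  avoids′ = trans (contains321-∷ N cs) (cong₂ _∨_ (∨-conicalʳ ((c <ᵇ N) ∧ anyLess′ c cs) _ first) (Avoids321-suffix [ c ] {cs} rest))

-- Layered permutations

θ²Fixed321Avoider : ℕ → List ℕ → Set
θ²Fixed321Avoider n π = IsPerm n π × Avoids321 π × θ (θ π) ≡ π

last-layer : ∀ {k π} → θ²Fixed321Avoider (suc k) π → ∃ λ B → π ≡ B ++ [ suc k ] ⊎ π ≡ B ++ suc k ∷ k ∷ []
last-layer {k} {π} (π-perm , avoids , θ²π≡π) =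
  B , Sum.map π≡B++N∷ π≡B++N∷ (tail-after-max A B π-perm σ-perm π≡ σ≡ refl refl O-sorted)
  where
  N : ℕ
  N = suc k
  σ : List ℕ
  σ = θ π
  σ-perm : IsPerm N σ
  σ-perm = Cycles.θ-IsPerm π π-perm
  A B : List ℕ
  A = concatMap (block π) (oneTo k)
  B = concatMap (block σ) (oneTo k)
  σ≡ : σ ≡ A ++ cycleOf π N
  σ≡ = θ-ends-with-cycle-of-max π π-perm
  π≡ : π ≡ B ++ cycleOf σ N
  π≡ = trans (sym θ²π≡π) (θ-ends-with-cycle-of-max σ σ-perm)
  O : List ℕ
  O = orbitFrom σ N (length σ) (at σ N)
  N∷O! : Unique (N ∷ O)
  N∷O! = Unique-suffix B (subst Unique π≡ (IsPerm⇒Unique {N} π-perm))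
  O<N : All (_< N) O
  O<N = All.tabulate λ {x} x∈O → ≤∧≢⇒< (proj₂ (∈-oneTo⁻ {N} (∈-resp-↭ π-perm (subst (x ∈_) (sym π≡) (∈-++⁺ʳ B (there x∈O))))))
                                       (λ x≡N → All.lookup (AllPairs.head N∷O!) x∈O (sym x≡N))
  O-sorted : AllPairs _<_ O
  O-sorted = Avoids321-below-first⇒sorted O (Avoids321-suffix B (subst Avoids321 π≡ avoids)) O<N (AllPairs.tail N∷O!)
  π≡B++N∷ : ∀ {O′} → O ≡ O′ → π ≡ B ++ N ∷ O′
  π≡B++N∷ O≡O′ = trans π≡ (cong (λ O → B ++ N ∷ O) O≡O′)

cycleOf-++ : ∀ {k} P R {m} → IsPerm k P → InRange k m → cycleOf (P ++ R) m ≡ cycleOf P m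
cycleOf-++ {k} P R {m} P-perm m∈ with q , p≤k , period ← Orbits.leastPeriod (IsPerm⇒Permutes {k} P-perm) m∈ = begin
  cycleOf (P ++ R) m        ≡⟨ cycleOf-iterate (P ++ R) (λ (_ , x≤k) → at-++ˡ P R (≤-trans x≤k (≤-reflexive (sym |P|≡k)))) m∈ q≤|P++R| period ⟩
  iterate (at P) m (suc q)  ≡⟨ sym (cycleOf-iterate P (λ _ → refl) m∈ q≤|P| period) ⟩
  cycleOf P m               ∎
  where
  open ≡-Reasoning
  open Orbits (IsPerm⇒Permutes {k} P-perm)
  |P|≡k : length P ≡ k
  |P|≡k = IsPerm⇒length {k} P-perm
  q≤|P| : q ≤ length P
  q≤|P| = ≤-trans (n≤1+n q) (≤-trans p≤k (≤-reflexive (sym |P|≡k)))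
  q≤|P++R| : q ≤ length (P ++ R)
  q≤|P++R| = ≤-trans q≤|P| (≤-trans (m≤m+n (length P) (length R)) (≤-reflexive (sym (length-++ P))))

θ-prefix : ∀ {k} P R → IsPerm k P → concatMap (block (P ++ R)) (oneTo k) ≡ θ P
θ-prefix {k} P R P-perm = begin
  concatMap (block (P ++ R)) (oneTo k)   ≡⟨ cong concat (map-cong-local (All.tabulate block-++)) ⟩
  concatMap (block P) (oneTo k)          ≡⟨ sym (Cycles.θ≡concatMap-block {k} P P-perm) ⟩
  θ P                                    ∎
  where
  open ≡-Reasoning
  block-++ : ∀ {m} → m ∈ oneTo k → block (P ++ R) m ≡ block P m
  block-++ {m} m∈ = cong (λ c → if not (anyGreater m c) then c else []) (cycleOf-++ {k} P R P-perm (∈-oneTo⁻ m∈))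

record Layer (k s : ℕ) (S : List ℕ) : Set where
  field
    perm⇔  : ∀ {P} → IsPerm k P ⇔ IsPerm (s + k) (P ++ S)
    above  : All (suc k ≤_) S
    avoids : Avoids321 S
    θ-++   : ∀ {P} → IsPerm k P → θ (P ++ S) ≡ θ P ++ S

  stack⇔ : ∀ {P} → θ²Fixed321Avoider k P ⇔ θ²Fixed321Avoider (s + k) (P ++ S)
  stack⇔ {P} = mk⇔ to from
    where
    below : IsPerm k P → Below P S
    below P-perm = All.tabulate λ x∈ → All.map (≤-trans (m≤n⇒m≤1+n (proj₂ (∈-oneTo⁻ {k} (∈-resp-↭ P-perm x∈))))) above
    θ²-++ : IsPerm k P → θ (θ (P ++ S)) ≡ θ (θ P) ++ S
    θ²-++ P-perm = trans (cong θ (θ-++ P-perm)) (θ-++ (Cycles.θ-IsPerm {k} P P-perm))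
    to : θ²Fixed321Avoider k P → θ²Fixed321Avoider (s + k) (P ++ S)
    to (P-perm , P-avoids , θ²P≡P) =
      Equivalence.to perm⇔ P-perm ,
      trans (contains321-++ P (below P-perm)) (cong₂ _∨_ P-avoids avoids) ,
      trans (θ²-++ P-perm) (cong (_++ S) θ²P≡P)
    from : θ²Fixed321Avoider (s + k) (P ++ S) → θ²Fixed321Avoider k P
    from (PS-perm , PS-avoids , θ²PS≡PS) =
      P-perm ,
      ∨-conicalˡ _ _ (trans (sym (contains321-++ P (below P-perm))) PS-avoids) ,
      ++-cancelʳ S (θ (θ P)) P (trans (sym (θ²-++ P-perm)) θ²PS≡PS)
      where
      P-perm : IsPerm k P
      P-perm = Equivalence.from perm⇔ PS-perm

  ∈-map-stack : ∀ {Ps π} → (∀ {P} → P ∈ Ps → θ²Fixed321Avoider k P) → π ∈ map (_++ S) Ps → θ²Fixed321Avoider (s + k) π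
  ∈-map-stack Ps-fixed π∈ with P , P∈ , refl ← ∈-map⁻ (_++ S) π∈ = Equivalence.to stack⇔ (Ps-fixed P∈)

singleton-layer : ∀ k → Layer k 1 [ suc k ]
singleton-layer k = record
  { perm⇔  = mk⇔ (++⁺ʳ [ suc k ]) (↭-++-cancelʳ [ suc k ])
  ; above  = ≤-refl ∷ []
  ; avoids = refl
  ; θ-++   = θ-++-top
  }
  where
  θ-++-top : ∀ {P} → IsPerm k P → θ (P ++ [ suc k ]) ≡ θ P ++ [ suc k ]
  θ-++-top {P} P-perm = begin
    θ (P ++ [ suc k ])                                               ≡⟨ θ-ends-with-cycle-of-max _ (++⁺ʳ [ suc k ] P-perm) ⟩
    concatMap (block (P ++ [ suc k ])) (oneTo k) ++ cycleOf (P ++ [ suc k ]) (suc k)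
                                                                     ≡⟨ cong₂ _++_ (θ-prefix {k} P _ P-perm)
                                                                          (cycleOf-fixed (P ++ [ suc k ]) (nonempty P (suc k) []) (at-above P [ suc k ] 0 P-perm)) ⟩
    θ P ++ [ suc k ]                                                 ∎
    where open ≡-Reasoning

transposition-layer : ∀ k → Layer k 2 (suc (suc k) ∷ suc k ∷ [])
transposition-layer k = record
  { perm⇔  = mk⇔ (λ P-perm → ↭-trans (++⁺ʳ S P-perm) oneTo-swapped) (λ PS-perm → ↭-++-cancelʳ S (↭-trans PS-perm (↭-sym oneTo-swapped)))
  ; above  = n≤1+n (suc k) ∷ ≤-refl ∷ []
  ; avoids = cong (λ b → ((b ∧ false) ∨ false) ∨ false) (<⇒<ᵇ≡true (n<1+n k))
  ; θ-++   = θ-++-top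
  }
  where
  S : List ℕ
  S = suc (suc k) ∷ suc k ∷ []
  oneTo-swapped : oneTo k ++ S ↭ oneTo (suc (suc k))
  oneTo-swapped = ↭-trans (++⁺ˡ (oneTo k) (swap _ _ ↭-refl)) (↭-reflexive (sym (++-assoc (oneTo k) [ suc k ] [ suc (suc k) ])))
  θ-++-top : ∀ {P} → IsPerm k P → θ (P ++ S) ≡ θ P ++ S
  θ-++-top {P} P-perm = begin
    θ τ                                                                  ≡⟨ θ-ends-with-cycle-of-max τ (↭-trans (++⁺ʳ S P-perm) oneTo-swapped) ⟩
    concatMap (block τ) (oneTo (suc k)) ++ cycleOf τ (suc (suc k))       ≡⟨ cong (_++ cycleOf τ (suc (suc k))) (concatMap-oneTo-suc (block τ) k) ⟩
    (concatMap (block τ) (oneTo k) ++ block τ (suc k)) ++ cycleOf τ (suc (suc k))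
                                                                         ≡⟨ cong₂ _++_ (cong₂ _++_ (θ-prefix {k} P S P-perm) lower-block) upper-cycle ⟩
    (θ P ++ []) ++ S                                                     ≡⟨ cong (_++ S) (++-identityʳ (θ P)) ⟩
    θ P ++ S                                                             ∎
    where
    open ≡-Reasoning
    τ : List ℕ
    τ = P ++ S
    |τ| : length τ ≡ suc (suc (length P))
    |τ| = trans (length-++ P) (+-comm (length P) 2)
    lower↦upper : at τ (suc k) ≡ suc (suc k)
    lower↦upper = at-above P S 0 P-perm
    upper↦lower : at τ (suc (suc k)) ≡ suc k
    upper↦lower = at-above P S 1 P-perm
    upper-cycle : cycleOf τ (suc (suc k)) ≡ S
    upper-cycle = cycleOf-transposed τ |τ| upper↦lower lower↦upper (1+n≢n ∘ sym)
    lower-block : block τ (suc k) ≡ []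
    lower-block = block-nonmax τ (suc k) (subst (suc (suc k) ∈_) (sym (cycleOf-transposed τ |τ| lower↦upper upper↦lower 1+n≢n)) (there (here refl))) ≤-refl

peel-last-layer : ∀ {k π} → θ²Fixed321Avoider (suc (suc k)) π →
                  (∃ λ B → θ²Fixed321Avoider (suc k) B × π ≡ B ++ [ suc (suc k) ]) ⊎
                  (∃ λ B → θ²Fixed321Avoider k B × π ≡ B ++ suc (suc k) ∷ suc k ∷ [])
peel-last-layer {k} {π} fixed =
  Sum.map (peel (singleton-layer (suc k)) fixed) (peel (transposition-layer k) fixed) (proj₂ (last-layer fixed))
  where
  B : List ℕ
  B = proj₁ (last-layer fixed)
  peel : ∀ {j s S} → Layer j s S → θ²Fixed321Avoider (s + j) π → π ≡ B ++ S → ∃ λ B → θ²Fixed321Avoider j B × π ≡ B ++ S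
  peel {j} {s} layer π-fixed π≡B++S =
    B , Equivalence.from (Layer.stack⇔ layer) (subst (θ²Fixed321Avoider (s + j)) π≡B++S π-fixed) , π≡B++S

-- The direct sums of copies of 1 and 21, i.e. the layered permutations with layers of size ≤ 2.
layered : ℕ → List (List ℕ)
layered zero = [ [] ]
layered (suc zero) = [ [ 1 ] ]
layered (suc (suc k)) = map (_++ [ suc (suc k) ]) (layered (suc k)) ++ map (_++ suc (suc k) ∷ suc k ∷ []) (layered k)

length-layered : ∀ n → length (layered n) ≡ fib (suc n)
length-layered zero = refl
length-layered (suc zero) = refl
length-layered (suc (suc k)) = begin
  length (map (_++ [ suc (suc k) ]) (layered (suc k)) ++ map (_++ suc (suc k) ∷ suc k ∷ []) (layered k))
    ≡⟨ length-++ (map (_++ [ suc (suc k) ]) (layered (suc k))) ⟩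
  length (map (_++ [ suc (suc k) ]) (layered (suc k))) + length (map (_++ suc (suc k) ∷ suc k ∷ []) (layered k))
    ≡⟨ cong₂ _+_ (trans (length-map _ (layered (suc k))) (length-layered (suc k))) (trans (length-map _ (layered k)) (length-layered k)) ⟩
  fib (suc (suc k)) + fib (suc k)
    ∎
  where open ≡-Reasoning

layered-unique : ∀ n → Unique (layered n)
layered-unique zero = [] ∷ []
layered-unique (suc zero) = [] ∷ []
layered-unique (suc (suc k)) =
  ++⁺ (map⁺ (λ {P} {P′} → ++-cancelʳ _ P P′) (layered-unique (suc k))) (map⁺ (λ {P} {P′} → ++-cancelʳ _ P P′) (layered-unique k)) disjoint
  where
  disjoint : ∀ {π} → ¬ (π ∈ map (_++ [ suc (suc k) ]) (layered (suc k)) × π ∈ map (_++ suc (suc k) ∷ suc k ∷ []) (layered k))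
  disjoint (π∈₁ , π∈₂) with P , _ , refl ← ∈-map⁻ (_++ [ suc (suc k) ]) π∈₁ | P′ , _ , eq ← ∈-map⁻ (_++ suc (suc k) ∷ suc k ∷ []) π∈₂ =
    1+n≢n (∷ʳ-injectiveʳ P (P′ ++ [ suc (suc k) ]) (trans eq (sym (++-assoc P′ [ suc (suc k) ] [ suc k ]))))

layered-sound : ∀ n {π} → π ∈ layered n → θ²Fixed321Avoider n π
layered-sound zero (here refl) = ↭-refl , refl , refl
layered-sound (suc zero) (here refl) = ↭-refl , refl , refl
layered-sound (suc (suc k)) π∈ =
  [ Layer.∈-map-stack (singleton-layer (suc k)) (layered-sound (suc k))
  , Layer.∈-map-stack (transposition-layer k) (layered-sound k)
  ]′ (∈-++⁻ (map (_++ [ suc (suc k) ]) (layered (suc k))) π∈)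

layered-complete : ∀ n {π} → θ²Fixed321Avoider n π → π ∈ layered n
layered-complete zero (π-perm , _) = here (↭-empty-inv π-perm)
layered-complete (suc zero) (π-perm , _) = here (↭-singleton-inv π-perm)
layered-complete (suc (suc k)) fixed =
  [ (λ (B , B-fixed , π≡) → subst (_∈ layered (suc (suc k))) (sym π≡)
      (∈-++⁺ˡ (∈-map⁺ (_++ [ suc (suc k) ]) (layered-complete (suc k) B-fixed))))
  , (λ (B , B-fixed , π≡) → subst (_∈ layered (suc (suc k))) (sym π≡)
      (∈-++⁺ʳ (map (_++ [ suc (suc k) ]) (layered (suc k))) (∈-map⁺ (_++ suc (suc k) ∷ suc k ∷ []) (layered-complete k B-fixed))))
  ]′ (peel-last-layer fixed)

theorem5p3 : (n : ℕ) → 2 ≤ n →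
    Σ (List (List ℕ)) λ L →
      Unique L ×
      ((π : List ℕ) → π ∈ L ⇔ (IsPerm n π × Avoids321 π × θ (θ π) ≡ π)) ×
      length L ≡ fib (suc n)
theorem5p3 n _ = layered n , layered-unique n , (λ π → mk⇔ (layered-sound n) (layered-complete n)) , length-layered n
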